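{- The assignment $(i,c)\mapsto\mathsf{Bel}(i,c)$ extends to a functor $\mathsf{Bel}\colon\mathbf{Coalg}_I(FT)\to\mathbf{Coalg}_I(FT)$ on the category of $I$-pointed partially observable $FT$-coalgebras, which sends a morphism $(f,g)\colon(i,\langle\delta,\mathrm{obs}\rangle)\to(i',\langle\delta',\mathrm{obs}'\rangle)$ (with $\mathrm{obs}\colon S\to O$, $\mathrm{obs}'\colon S'\to O'$) to $(\overline{T}_{O'}(f)\circ\theta_{g,\mathrm{obs}},\ g)$, where $\theta_{g,\mathrm{obs}}\colon\overline{T}_OS_{\mathrm{obs}}\to\overline{T}_{O'}S_{g\circ\mathrm{obs}}$ and $\overline{T}_{O'}(f)\colon\overline{T}_{O'}S_{g\circ\mathrm{obs}}\to\overline{T}_{O'}S'_{\mathrm{obs}'}$ is the action of $\overline{T}_{O'}$ on the morphism $f\colon(g\circ\mathrm{obs})\to\mathrm{obs}'$ of $\mathcal{C}/O'$.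
   Context: $\mathcal{C}$ is a category with finite products and pullbacks (fixed choice of pullbacks); $\mathcal{O}$ is a wide subcategory of $\mathcal{C}$; $F$ is an endofunctor, $T=(T,\eta,\mu)$ a monad, and $\lambda\colon TF\Rightarrow FT$ a distributive law ($\lambda_X\circ\eta_{FX}=F\eta_X$, $F\mu_X\circ\lambda_{TX}\circ T\lambda_X=\lambda_X\circ\mu_{FX}$); $I$ is a fixed object. For $f\colon X\to O$, $\overline{T}_O(f)\colon\overline{T}_OX_f\to O$ and $\iota_f\colon\overline{T}_OX_f\to TX$ form the chosen pullback of $\eta_O$ along $Tf$; this defines a monad $\overline{T}_O$ on $\mathcal{C}/O$ (induced by the Eilenberg–Moore adjunction sliced over $O$) whose unit $\eta^{\overline{T}}_f\colon X\to\overline{T}_OX_f$ is induced by the pair $(\eta_X,f)$; $d\colon\mathcal{C}/O\to\mathcal{C}$ is the forgetful functor. For $u\colon O\to O'$ and $f\colon X\to O$, $\theta_{u,f}\colon\overline{T}_OX_f\to\overline{T}_{O'}X_{u\circ f}$ is induced by the pair $(\iota_f,u\circ\overline{T}_O(f))$. Let $\mathsf{flat}^O_f:=\mu_X\circ T\iota_f$. A fixed belief decomposition is a family of natural transformations $\alpha^O\colon Td\Rightarrow Td\overline{T}_O$ (components $\alpha^O_f\colon TX\to T(\overline{T}_OX_f)$), one for each object $O$, with $\mathsf{flat}^O_f\circ\alpha^O_f=\mathrm{id}$ and $T(\theta_{u,f})\circ\alpha^O_f=\alpha^{O'}_{u\circ f}$ for all $u\colon O\to O'$ in $\mathcal{O}$.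 An $I$-pointed partially observable $FT$-coalgebra is $(i,\langle\delta,\mathrm{obs}\rangle)$ with $i\colon I\to S$, $\delta\colon S\to FTS$, $\mathrm{obs}\colon S\to O$; a morphism $(f,g)\colon(i,\langle\delta,\mathrm{obs}\rangle)\to(i',\langle\delta',\mathrm{obs}'\rangle)$ consists of $f\colon S\to S'$ in $\mathcal{C}$ and $g\colon O\to O'$ in $\mathcal{O}$ with $f\circ i=i'$, $\delta'\circ f=FTf\circ\delta$ and $g\circ\mathrm{obs}=\mathrm{obs}'\circ f$; these form the category $\mathbf{Coalg}_I(FT)$. With $\mathrm{Det}(\delta):=F\mu_S\circ\lambda_{TS}\circ T\delta\colon TS\to FTS$, define $c^{\mathsf{Bel}}:=F\alpha^O_{\mathrm{obs}}\circ\mathrm{Det}(\delta)\circ\iota_{\mathrm{obs}}\colon\overline{T}_OS_{\mathrm{obs}}\to FT(\overline{T}_OS_{\mathrm{obs}})$ and $\mathsf{Bel}(i,\langle\delta,\mathrm{obs}\rangle):=(\eta^{\overline{T}}_{\mathrm{obs}}\circ i,\ \langle c^{\mathsf{Bel}},\overline{T}_O(\mathrm{obs})\rangle)$. -}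

module Defs where

open import Level using (Level; _⊔_) renaming (suc to lsuc)
open import Relation.Binary using (Rel; IsEquivalence; Setoid)
open import Data.Product using (_,_) renaming (_×_ to _∧_)
import Relation.Binary.Reasoning.Setoid as SetoidR

record Category (o ℓ e : Level) : Set (lsuc (o ⊔ ℓ ⊔ e)) where
  infixr 9 _∘_
  infix  4 _≈_
  field
    Obj : Set o
    _⇒_ : Obj → Obj → Set ℓ
    _≈_ : ∀ {A B} → Rel (A ⇒ B) e
    id  : ∀ {A} → A ⇒ A
    _∘_ : ∀ {A B C} → B ⇒ C → A ⇒ B → A ⇒ C
    equiv     : ∀ {A B} → IsEquivalence (_≈_ {A} {B})
    ∘-resp-≈  : ∀ {A B C} {f f' : B ⇒ C} {g g' : A ⇒ B} →
                f ≈ f' → g ≈ g' → f ∘ g ≈ f' ∘ g'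
    assoc     : ∀ {A B C D} {f : A ⇒ B} {g : B ⇒ C} {h : C ⇒ D} →
                (h ∘ g) ∘ f ≈ h ∘ (g ∘ f)
    identityˡ : ∀ {A B} {f : A ⇒ B} → id ∘ f ≈ f
    identityʳ : ∀ {A B} {f : A ⇒ B} → f ∘ id ≈ f

  hom-setoid : ∀ {A B} → Setoid ℓ e
  hom-setoid {A} {B} = record { Carrier = A ⇒ B ; _≈_ = _≈_ ; isEquivalence = equiv }

  module _ {A B : Obj} where
    open IsEquivalence (equiv {A} {B}) public
      renaming (refl to ≈-refl; sym to ≈-sym; trans to ≈-trans)

record FunctorExtending {o ℓ e o' ℓ' e'} (C : Category o ℓ e) (D : Category o' ℓ' e')
         (F₀ : Category.Obj C → Category.Obj D) : Set (o ⊔ ℓ ⊔ e ⊔ ℓ' ⊔ e') where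
  private
    module C = Category C
    module D = Category D
  field
    F₁           : ∀ {A B} → A C.⇒ B → F₀ A D.⇒ F₀ B
    F-resp-≈     : ∀ {A B} {f g : A C.⇒ B} → f C.≈ g → F₁ f D.≈ F₁ g
    identity     : ∀ {A} → F₁ (C.id {A}) D.≈ D.id
    homomorphism : ∀ {A B Cc} {f : A C.⇒ B} {g : B C.⇒ Cc} →
                   F₁ (g C.∘ f) D.≈ F₁ g D.∘ F₁ f

record Endofunctor {o ℓ e} (C : Category o ℓ e) : Set (o ⊔ ℓ ⊔ e) where
  open Category C
  field
    F₀ : Obj → Obj
    F₁ : ∀ {A B} → A ⇒ B → F₀ A ⇒ F₀ B
    identity     : ∀ {A} → F₁ (id {A}) ≈ id
    homomorphism : ∀ {A B Cc} {f : A ⇒ B} {g : B ⇒ Cc} → F₁ (g ∘ f) ≈ F₁ g ∘ F₁ f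
    F-resp-≈     : ∀ {A B} {f g : A ⇒ B} → f ≈ g → F₁ f ≈ F₁ g

record Monad {o ℓ e} (C : Category o ℓ e) : Set (o ⊔ ℓ ⊔ e) where
  open Category C
  field
    functor : Endofunctor C
  open Endofunctor functor public
  field
    η : ∀ X → X ⇒ F₀ X
    μ : ∀ X → F₀ (F₀ X) ⇒ F₀ X
    η-natural : ∀ {X Y} (f : X ⇒ Y) → F₁ f ∘ η X ≈ η Y ∘ f
    μ-natural : ∀ {X Y} (f : X ⇒ Y) → F₁ f ∘ μ X ≈ μ Y ∘ F₁ (F₁ f)
    μ-assoc   : ∀ {X} → μ X ∘ F₁ (μ X) ≈ μ X ∘ μ (F₀ X)
    μ-identityˡ : ∀ {X} → μ X ∘ F₁ (η X) ≈ id
    μ-identityʳ : ∀ {X} → μ X ∘ η (F₀ X) ≈ id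

record DistributiveLaw {o ℓ e} (C : Category o ℓ e) (F : Endofunctor C) (T : Monad C)
         : Set (o ⊔ ℓ ⊔ e) where
  open Category C
  private
    module F = Endofunctor F
    module T = Monad T
  field
    λ′ : ∀ X → T.F₀ (F.F₀ X) ⇒ F.F₀ (T.F₀ X)
    natural : ∀ {X Y} (f : X ⇒ Y) → F.F₁ (T.F₁ f) ∘ λ′ X ≈ λ′ Y ∘ T.F₁ (F.F₁ f)
    unit-law : ∀ X → λ′ X ∘ T.η (F.F₀ X) ≈ F.F₁ (T.η X)
    mult-law : ∀ X → (F.F₁ (T.μ X) ∘ λ′ (T.F₀ X)) ∘ T.F₁ (λ′ X) ≈ λ′ X ∘ T.μ (F.F₀ X)

record FiniteProducts {o ℓ e} (C : Category o ℓ e) : Set (o ⊔ ℓ ⊔ e) where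
  open Category C
  field
    ⊤ : Obj
    ! : ∀ {A} → A ⇒ ⊤
    !-unique : ∀ {A} (h : A ⇒ ⊤) → h ≈ !
    _×_ : Obj → Obj → Obj
    π₁ : ∀ {A B} → (A × B) ⇒ A
    π₂ : ∀ {A B} → (A × B) ⇒ B
    ⟨_,_⟩ : ∀ {X A B} → X ⇒ A → X ⇒ B → X ⇒ (A × B)
    project₁ : ∀ {X A B} {h : X ⇒ A} {k : X ⇒ B} → π₁ ∘ ⟨ h , k ⟩ ≈ h
    project₂ : ∀ {X A B} {h : X ⇒ A} {k : X ⇒ B} → π₂ ∘ ⟨ h , k ⟩ ≈ k
    ⟨⟩-unique : ∀ {X A B} {h : X ⇒ A} {k : X ⇒ B} (u : X ⇒ (A × B)) →
                π₁ ∘ u ≈ h → π₂ ∘ u ≈ k → u ≈ ⟨ h , k ⟩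

record ChosenPullbacks {o ℓ e} (C : Category o ℓ e) : Set (o ⊔ ℓ ⊔ e) where
  open Category C
  field
    P  : ∀ {A B Z} → A ⇒ Z → B ⇒ Z → Obj
    p₁ : ∀ {A B Z} (f : A ⇒ Z) (g : B ⇒ Z) → P f g ⇒ A
    p₂ : ∀ {A B Z} (f : A ⇒ Z) (g : B ⇒ Z) → P f g ⇒ B
    commute : ∀ {A B Z} (f : A ⇒ Z) (g : B ⇒ Z) → f ∘ p₁ f g ≈ g ∘ p₂ f g
    universal : ∀ {A B Z X} (f : A ⇒ Z) (g : B ⇒ Z) (h₁ : X ⇒ A) (h₂ : X ⇒ B) →
                f ∘ h₁ ≈ g ∘ h₂ → X ⇒ P f g
    p₁∘universal : ∀ {A B Z X} {f : A ⇒ Z} {g : B ⇒ Z} {h₁ : X ⇒ A} {h₂ : X ⇒ B}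
                   (eq : f ∘ h₁ ≈ g ∘ h₂) → p₁ f g ∘ universal f g h₁ h₂ eq ≈ h₁
    p₂∘universal : ∀ {A B Z X} {f : A ⇒ Z} {g : B ⇒ Z} {h₁ : X ⇒ A} {h₂ : X ⇒ B}
                   (eq : f ∘ h₁ ≈ g ∘ h₂) → p₂ f g ∘ universal f g h₁ h₂ eq ≈ h₂
    unique : ∀ {A B Z X} {f : A ⇒ Z} {g : B ⇒ Z} {h₁ : X ⇒ A} {h₂ : X ⇒ B}
             (eq : f ∘ h₁ ≈ g ∘ h₂) (u : X ⇒ P f g) →
             p₁ f g ∘ u ≈ h₁ → p₂ f g ∘ u ≈ h₂ → u ≈ universal f g h₁ h₂ eq

record WideSubcategory {o ℓ e} (C : Category o ℓ e) (p : Level) : Set (o ⊔ ℓ ⊔ lsuc p) where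
  open Category C
  field
    Mor : ∀ {A B} → A ⇒ B → Set p
    id-closed : ∀ {A} → Mor (id {A})
    ∘-closed  : ∀ {A B Cc} {f : A ⇒ B} {g : B ⇒ Cc} → Mor g → Mor f → Mor (g ∘ f)

-- The sliced monad  T̄_O  (only the parts needed: object part via the
-- chosen pullback of η_O along T f, unit, action on slice morphisms, θ)

module Slice {o ℓ e} (C : Category o ℓ e) (pbs : ChosenPullbacks C) (T : Monad C) where
  open Category C
  open ChosenPullbacks pbs
  private module T = Monad T

  -- for f : X → O,  T̄_O X_f  together with  T̄_O(f) : T̄_O X_f → O  and  ι_f : T̄_O X_f → T X
  T̄ob : ∀ {X O} → X ⇒ O → Obj
  T̄ob {X} {O} f = P (T.F₁ f) (T.η O)

  ι : ∀ {X O} (f : X ⇒ O) → T̄ob f ⇒ T.F₀ X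
  ι {X} {O} f = p₁ (T.F₁ f) (T.η O)

  T̄ : ∀ {X O} (f : X ⇒ O) → T̄ob f ⇒ O
  T̄ {X} {O} f = p₂ (T.F₁ f) (T.η O)

  η̄ : ∀ {X O} (f : X ⇒ O) → X ⇒ T̄ob f
  η̄ {X} {O} f = universal (T.F₁ f) (T.η O) (T.η X) f (T.η-natural f)

  θ : ∀ {X O O'} (u : O ⇒ O') (f : X ⇒ O) → T̄ob f ⇒ T̄ob (u ∘ f)
  θ {X} {O} {O'} u f = universal (T.F₁ (u ∘ f)) (T.η O') (ι f) (u ∘ T̄ f) pf
    where
      open SetoidR (hom-setoid {T̄ob f} {T.F₀ O'})
      pf : T.F₁ (u ∘ f) ∘ ι f ≈ T.η O' ∘ (u ∘ T̄ f)
      pf = begin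
        T.F₁ (u ∘ f) ∘ ι f          ≈⟨ ∘-resp-≈ T.homomorphism ≈-refl ⟩
        (T.F₁ u ∘ T.F₁ f) ∘ ι f     ≈⟨ assoc ⟩
        T.F₁ u ∘ (T.F₁ f ∘ ι f)     ≈⟨ ∘-resp-≈ ≈-refl (commute (T.F₁ f) (T.η O)) ⟩
        T.F₁ u ∘ (T.η O ∘ T̄ f)      ≈⟨ ≈-sym assoc ⟩
        (T.F₁ u ∘ T.η O) ∘ T̄ f      ≈⟨ ∘-resp-≈ (T.η-natural u) ≈-refl ⟩
        (T.η O' ∘ u) ∘ T̄ f          ≈⟨ assoc ⟩
        T.η O' ∘ (u ∘ T̄ f)          ∎

  T̄₁ : ∀ {X Y O} {f : X ⇒ O} {f' : Y ⇒ O} (h : X ⇒ Y) → f' ∘ h ≈ f → T̄ob f ⇒ T̄ob f'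
  T̄₁ {X} {Y} {O} {f} {f'} h eq = universal (T.F₁ f') (T.η O) (T.F₁ h ∘ ι f) (T̄ f) pf
    where
      open SetoidR (hom-setoid {T̄ob f} {T.F₀ O})
      pf : T.F₁ f' ∘ (T.F₁ h ∘ ι f) ≈ T.η O ∘ T̄ f
      pf = begin
        T.F₁ f' ∘ (T.F₁ h ∘ ι f)    ≈⟨ ≈-sym assoc ⟩
        (T.F₁ f' ∘ T.F₁ h) ∘ ι f    ≈⟨ ∘-resp-≈ (≈-sym T.homomorphism) ≈-refl ⟩
        T.F₁ (f' ∘ h) ∘ ι f         ≈⟨ ∘-resp-≈ (T.F-resp-≈ eq) ≈-refl ⟩
        T.F₁ f ∘ ι f                ≈⟨ commute (T.F₁ f) (T.η O) ⟩
        T.η O ∘ T̄ f                 ∎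

  flat : ∀ {X O} (f : X ⇒ O) → T.F₀ (T̄ob f) ⇒ T.F₀ X
  flat {X} f = T.μ X ∘ T.F₁ (ι f)

record BeliefDecomposition {o ℓ e p} (C : Category o ℓ e) (pbs : ChosenPullbacks C)
         (𝒪 : WideSubcategory C p) (T : Monad C) : Set (o ⊔ ℓ ⊔ e ⊔ p) where
  open Category C
  open Slice C pbs T
  private
    module T = Monad T
    module 𝒪 = WideSubcategory 𝒪
  field
    α : ∀ {X O} (f : X ⇒ O) → T.F₀ X ⇒ T.F₀ (T̄ob f)
    α-natural : ∀ {X Y O} {f : X ⇒ O} {f' : Y ⇒ O} (h : X ⇒ Y) (eq : f' ∘ h ≈ f) →
                T.F₁ (T̄₁ h eq) ∘ α f ≈ α f' ∘ T.F₁ h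
    flat∘α : ∀ {X O} (f : X ⇒ O) → flat f ∘ α f ≈ id
    θ∘α : ∀ {X O O'} (u : O ⇒ O') → 𝒪.Mor u → (f : X ⇒ O) →
          T.F₁ (θ u f) ∘ α f ≈ α (u ∘ f)

module POCoalg {o ℓ e p} (C : Category o ℓ e) (pbs : ChosenPullbacks C)
         (𝒪 : WideSubcategory C p) (F : Endofunctor C) (T : Monad C)
         (L : DistributiveLaw C F T) (I : Category.Obj C)
         (B : BeliefDecomposition C pbs 𝒪 T) where
  open Category C
  open Slice C pbs T public
  open BeliefDecomposition B public
  private
    module T = Monad T
    module F = Endofunctor F
    module 𝒪 = WideSubcategory 𝒪
    module L = DistributiveLaw L

  record PObj : Set (o ⊔ ℓ) where
    field
      S   : Obj
      O   : Obj
      i   : I ⇒ S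
      δ   : S ⇒ F.F₀ (T.F₀ S)
      obs : S ⇒ O
  open PObj

  record PHom (X Y : PObj) : Set (ℓ ⊔ e ⊔ p) where
    field
      f : S X ⇒ S Y
      g : O X ⇒ O Y
      g∈𝒪 : 𝒪.Mor g
      pointed : f ∘ i X ≈ i Y
      coalg   : δ Y ∘ f ≈ F.F₁ (T.F₁ f) ∘ δ X
      observe : g ∘ obs X ≈ obs Y ∘ f
  open PHom

  private
    idH : ∀ {X} → PHom X X
    idH {X} = record
      { f = id ; g = id ; g∈𝒪 = 𝒪.id-closed
      ; pointed = identityˡ
      ; coalg = begin
          δ X ∘ id                  ≈⟨ identityʳ ⟩
          δ X                       ≈⟨ ≈-sym identityˡ ⟩
          id ∘ δ X                  ≈⟨ ∘-resp-≈ (≈-sym F.identity) ≈-refl ⟩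
          F.F₁ id ∘ δ X             ≈⟨ ∘-resp-≈ (F.F-resp-≈ (≈-sym T.identity)) ≈-refl ⟩
          F.F₁ (T.F₁ id) ∘ δ X      ∎
      ; observe = ≈-trans identityˡ (≈-sym identityʳ) }
      where open SetoidR (hom-setoid {S X} {F.F₀ (T.F₀ (S X))})

    compH : ∀ {X Y Z} → PHom Y Z → PHom X Y → PHom X Z
    compH {X} {Y} {Z} m n = record
      { f = f m ∘ f n ; g = g m ∘ g n ; g∈𝒪 = 𝒪.∘-closed (g∈𝒪 m) (g∈𝒪 n)
      ; pointed = let open SetoidR (hom-setoid {I} {S Z}) in begin
          (f m ∘ f n) ∘ i X     ≈⟨ assoc ⟩
          f m ∘ (f n ∘ i X)     ≈⟨ ∘-resp-≈ ≈-refl (pointed n) ⟩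
          f m ∘ i Y             ≈⟨ pointed m ⟩
          i Z                   ∎
      ; coalg = let open SetoidR (hom-setoid {S X} {F.F₀ (T.F₀ (S Z))}) in begin
          δ Z ∘ (f m ∘ f n)                          ≈⟨ ≈-sym assoc ⟩
          (δ Z ∘ f m) ∘ f n                          ≈⟨ ∘-resp-≈ (coalg m) ≈-refl ⟩
          (F.F₁ (T.F₁ (f m)) ∘ δ Y) ∘ f n            ≈⟨ assoc ⟩
          F.F₁ (T.F₁ (f m)) ∘ (δ Y ∘ f n)            ≈⟨ ∘-resp-≈ ≈-refl (coalg n) ⟩
          F.F₁ (T.F₁ (f m)) ∘ (F.F₁ (T.F₁ (f n)) ∘ δ X) ≈⟨ ≈-sym assoc ⟩
          (F.F₁ (T.F₁ (f m)) ∘ F.F₁ (T.F₁ (f n))) ∘ δ X ≈⟨ ∘-resp-≈ (≈-sym F.homomorphism) ≈-refl ⟩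
          F.F₁ (T.F₁ (f m) ∘ T.F₁ (f n)) ∘ δ X       ≈⟨ ∘-resp-≈ (F.F-resp-≈ (≈-sym T.homomorphism)) ≈-refl ⟩
          F.F₁ (T.F₁ (f m ∘ f n)) ∘ δ X              ∎
      ; observe = let open SetoidR (hom-setoid {S X} {O Z}) in begin
          (g m ∘ g n) ∘ obs X   ≈⟨ assoc ⟩
          g m ∘ (g n ∘ obs X)   ≈⟨ ∘-resp-≈ ≈-refl (observe n) ⟩
          g m ∘ (obs Y ∘ f n)   ≈⟨ ≈-sym assoc ⟩
          (g m ∘ obs Y) ∘ f n   ≈⟨ ∘-resp-≈ (observe m) ≈-refl ⟩
          (obs Z ∘ f m) ∘ f n   ≈⟨ assoc ⟩
          obs Z ∘ (f m ∘ f n)   ∎ }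

  Coalg : Category (o ⊔ ℓ) (ℓ ⊔ e ⊔ p) e
  Coalg = record
    { Obj = PObj
    ; _⇒_ = PHom
    ; _≈_ = λ m n → (f m ≈ f n) ∧ (g m ≈ g n)
    ; id = idH
    ; _∘_ = compH
    ; equiv = record
        { refl = ≈-refl , ≈-refl
        ; sym = λ (a , b) → ≈-sym a , ≈-sym b
        ; trans = λ (a , b) (c , d) → ≈-trans a c , ≈-trans b d }
    ; ∘-resp-≈ = λ (a , b) (c , d) → ∘-resp-≈ a c , ∘-resp-≈ b d
    ; assoc = assoc , assoc
    ; identityˡ = identityˡ , identityˡ
    ; identityʳ = identityʳ , identityʳ
    }

  Det : ∀ {S} → S ⇒ F.F₀ (T.F₀ S) → T.F₀ S ⇒ F.F₀ (T.F₀ S)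
  Det {S} δ′ = (F.F₁ (T.μ S) ∘ L.λ′ (T.F₀ S)) ∘ T.F₁ δ′

  cBel : (X : PObj) → T̄ob (obs X) ⇒ F.F₀ (T.F₀ (T̄ob (obs X)))
  cBel X = F.F₁ (α (obs X)) ∘ (Det (δ X) ∘ ι (obs X))

  Bel₀ : PObj → PObj
  Bel₀ X = record
    { S = T̄ob (obs X)
    ; O = O X
    ; i = η̄ (obs X) ∘ i X
    ; δ = cBel X
    ; obs = T̄ (obs X)
    }

-- A coalgebra morphism (f, g) acts on belief states by the map  T̄₁ f ∘ θ_g ,
-- which is the unique arrow into the pullback T̄_{O'} S' whose projections are
-- T f ∘ ι and g ∘ T̄.  Joint monicity of the pullback projections therefore gives
-- functoriality for free, and preservation of the unit reduces to naturality of η.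
-- Preservation of the coalgebra structure splits into naturality of Det(δ) in
-- coalgebra morphisms (naturality of μ and λ) and compatibility of the belief
-- decomposition α with that map (naturality of α together with T θ ∘ α = α).
module Submission where

open import Defs
open import Data.Product using (Σ; _×_; _,_)

module HomReasoning {o ℓ e} (C : Category o ℓ e) where
  open Category C

  infix  1 begin_
  infixr 2 _≈⟨_⟩_ _≈⟨_⟨_
  infix  3 _∎

  begin_ : ∀ {A B} {x y : A ⇒ B} → x ≈ y → x ≈ y
  begin p = p

  _≈⟨_⟩_ : ∀ {A B} (x : A ⇒ B) {y z : A ⇒ B} → x ≈ y → y ≈ z → x ≈ z
  _ ≈⟨ p ⟩ q = ≈-trans p q

  _≈⟨_⟨_ : ∀ {A B} (x : A ⇒ B) {y z : A ⇒ B} → y ≈ x → y ≈ z → x ≈ z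
  _ ≈⟨ p ⟨ q = ≈-trans (≈-sym p) q

  _∎ : ∀ {A B} (x : A ⇒ B) → x ≈ x
  _ ∎ = ≈-refl

  pullˡ : ∀ {A B D E} {a : D ⇒ E} {b : B ⇒ D} {c : A ⇒ B} {d : B ⇒ E} →
          a ∘ b ≈ d → a ∘ (b ∘ c) ≈ d ∘ c
  pullˡ p = ≈-trans (≈-sym assoc) (∘-resp-≈ p ≈-refl)

  pullʳ : ∀ {A B D E} {a : D ⇒ E} {b : B ⇒ D} {c : A ⇒ B} {d : A ⇒ D} →
          b ∘ c ≈ d → (a ∘ b) ∘ c ≈ a ∘ d
  pullʳ p = ≈-trans assoc (∘-resp-≈ ≈-refl p)

  extendʳ : ∀ {A B D E G} {a : D ⇒ E} {b : B ⇒ D} {c : A ⇒ B} {a' : G ⇒ E} {b' : B ⇒ G} →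
            a ∘ b ≈ a' ∘ b' → a ∘ (b ∘ c) ≈ a' ∘ (b' ∘ c)
  extendʳ p = ≈-trans (pullˡ p) assoc

  F-resp-square : (F : Endofunctor C) → let module F = Endofunctor F in
                  ∀ {A B B' D} {a : B ⇒ D} {b : A ⇒ B} {a' : B' ⇒ D} {b' : A ⇒ B'} →
                  a ∘ b ≈ a' ∘ b' → F.F₁ a ∘ F.F₁ b ≈ F.F₁ a' ∘ F.F₁ b'
  F-resp-square F p =
    ≈-trans (≈-sym F.homomorphism) (≈-trans (F.F-resp-≈ p) F.homomorphism)
    where module F = Endofunctor F

module PullbackProperties {o ℓ e} (C : Category o ℓ e) (pbs : ChosenPullbacks C) where
  open Category C
  open ChosenPullbacks pbs

  pullback-jointly-monic : ∀ {A B Z X} {f : A ⇒ Z} {g : B ⇒ Z} {u v : X ⇒ P f g} →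
                           p₁ f g ∘ u ≈ p₁ f g ∘ v → p₂ f g ∘ u ≈ p₂ f g ∘ v → u ≈ v
  pullback-jointly-monic {f = f} {g} {u} {v} eq₁ eq₂ =
    ≈-trans (unique square u eq₁ eq₂) (≈-sym (unique square v ≈-refl ≈-refl))
    where
      open HomReasoning C
      square : f ∘ (p₁ f g ∘ v) ≈ g ∘ (p₂ f g ∘ v)
      square = extendʳ (commute f g)

module SliceProperties {o ℓ e} (C : Category o ℓ e) (pbs : ChosenPullbacks C) (T : Monad C) where
  open Category C
  open ChosenPullbacks pbs
  open Slice C pbs T
  open HomReasoning C
  open PullbackProperties C pbs
  private module T = Monad T

  T̄sq : ∀ {X Y O O'} {f : X ⇒ O} {f' : Y ⇒ O'} (h : X ⇒ Y) (u : O ⇒ O') →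
        u ∘ f ≈ f' ∘ h → T̄ob f ⇒ T̄ob f'
  T̄sq {f = f} h u sq = T̄₁ h (≈-sym sq) ∘ θ u f

  module _ {X Y O O'} {f : X ⇒ O} {f' : Y ⇒ O'} {h : X ⇒ Y} {u : O ⇒ O'}
           {sq : u ∘ f ≈ f' ∘ h} where

    ι∘T̄sq : ι f' ∘ T̄sq h u sq ≈ T.F₁ h ∘ ι f
    ι∘T̄sq = ≈-trans (extendʳ (p₁∘universal _)) (∘-resp-≈ ≈-refl (p₁∘universal _))

    T̄∘T̄sq : T̄ f' ∘ T̄sq h u sq ≈ u ∘ T̄ f
    T̄∘T̄sq = ≈-trans (pullˡ (p₂∘universal _)) (p₂∘universal _)

    T̄sq-unique : ∀ {v : T̄ob f ⇒ T̄ob f'} →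
                 ι f' ∘ v ≈ T.F₁ h ∘ ι f → T̄ f' ∘ v ≈ u ∘ T̄ f → v ≈ T̄sq h u sq
    T̄sq-unique eq₁ eq₂ =
      pullback-jointly-monic (≈-trans eq₁ (≈-sym ι∘T̄sq)) (≈-trans eq₂ (≈-sym T̄∘T̄sq))

    T̄sq∘η̄ : T̄sq h u sq ∘ η̄ f ≈ η̄ f' ∘ h
    T̄sq∘η̄ = pullback-jointly-monic
      (begin
        ι f' ∘ (T̄sq h u sq ∘ η̄ f)  ≈⟨ extendʳ ι∘T̄sq ⟩
        T.F₁ h ∘ (ι f ∘ η̄ f)       ≈⟨ ∘-resp-≈ ≈-refl (p₁∘universal _) ⟩
        T.F₁ h ∘ T.η X             ≈⟨ T.η-natural h ⟩
        T.η Y ∘ h                  ≈⟨ pullˡ (p₁∘universal _) ⟨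
        ι f' ∘ (η̄ f' ∘ h)          ∎)
      (begin
        T̄ f' ∘ (T̄sq h u sq ∘ η̄ f)  ≈⟨ extendʳ T̄∘T̄sq ⟩
        u ∘ (T̄ f ∘ η̄ f)            ≈⟨ ∘-resp-≈ ≈-refl (p₂∘universal _) ⟩
        u ∘ f                      ≈⟨ sq ⟩
        f' ∘ h                     ≈⟨ pullˡ (p₂∘universal _) ⟨
        T̄ f' ∘ (η̄ f' ∘ h)          ∎)

  T̄sq-resp-≈ : ∀ {X Y O O'} {f : X ⇒ O} {f' : Y ⇒ O'} {h h' : X ⇒ Y} {u u' : O ⇒ O'}
               {sq : u ∘ f ≈ f' ∘ h} {sq' : u' ∘ f ≈ f' ∘ h'} →
               h ≈ h' → u ≈ u' → T̄sq h u sq ≈ T̄sq h' u' sq'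
  T̄sq-resp-≈ h≈h' u≈u' = T̄sq-unique
    (≈-trans ι∘T̄sq (∘-resp-≈ (T.F-resp-≈ h≈h') ≈-refl))
    (≈-trans T̄∘T̄sq (∘-resp-≈ u≈u' ≈-refl))

  T̄sq-identity : ∀ {X O} {f : X ⇒ O} {sq : id ∘ f ≈ f ∘ id} → T̄sq id id sq ≈ id
  T̄sq-identity = ≈-sym (T̄sq-unique
    (≈-trans identityʳ (≈-sym (≈-trans (∘-resp-≈ T.identity ≈-refl) identityˡ)))
    (≈-trans identityʳ (≈-sym identityˡ)))

  T̄sq-homomorphism : ∀ {X Y Z O O' O''} {f : X ⇒ O} {f' : Y ⇒ O'} {f'' : Z ⇒ O''}
                     {h₁ : X ⇒ Y} {u₁ : O ⇒ O'} {h₂ : Y ⇒ Z} {u₂ : O' ⇒ O''}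
                     {sq₁ : u₁ ∘ f ≈ f' ∘ h₁} {sq₂ : u₂ ∘ f' ≈ f'' ∘ h₂}
                     {sq : (u₂ ∘ u₁) ∘ f ≈ f'' ∘ (h₂ ∘ h₁)} →
                     T̄sq (h₂ ∘ h₁) (u₂ ∘ u₁) sq ≈ T̄sq h₂ u₂ sq₂ ∘ T̄sq h₁ u₁ sq₁
  T̄sq-homomorphism {f = f} {f'' = f''} {h₁} {u₁} {h₂} {u₂} {sq₁} {sq₂} = ≈-sym (T̄sq-unique
    (begin
      ι f'' ∘ (T̄sq h₂ u₂ sq₂ ∘ T̄sq h₁ u₁ sq₁)  ≈⟨ extendʳ ι∘T̄sq ⟩
      T.F₁ h₂ ∘ (ι _ ∘ T̄sq h₁ u₁ sq₁)         ≈⟨ ∘-resp-≈ ≈-refl ι∘T̄sq ⟩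
      T.F₁ h₂ ∘ (T.F₁ h₁ ∘ ι f)               ≈⟨ pullˡ (≈-sym T.homomorphism) ⟩
      T.F₁ (h₂ ∘ h₁) ∘ ι f                    ∎)
    (begin
      T̄ f'' ∘ (T̄sq h₂ u₂ sq₂ ∘ T̄sq h₁ u₁ sq₁)  ≈⟨ extendʳ T̄∘T̄sq ⟩
      u₂ ∘ (T̄ _ ∘ T̄sq h₁ u₁ sq₁)              ≈⟨ ∘-resp-≈ ≈-refl T̄∘T̄sq ⟩
      u₂ ∘ (u₁ ∘ T̄ f)                         ≈⟨ assoc ⟨
      (u₂ ∘ u₁) ∘ T̄ f                         ∎))

module BeliefFunctor {o ℓ e p} (C : Category o ℓ e) (pbs : ChosenPullbacks C)
         (𝒪 : WideSubcategory C p) (F : Endofunctor C) (T : Monad C)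
         (L : DistributiveLaw C F T) (I : Category.Obj C)
         (B : BeliefDecomposition C pbs 𝒪 T) where
  open Category C
  open POCoalg C pbs 𝒪 F T L I B
  open SliceProperties C pbs T
  open HomReasoning C
  open PObj
  open PHom
  private
    module T = Monad T
    module F = Endofunctor F
    module L = DistributiveLaw L
    module 𝒪 = WideSubcategory 𝒪

  α-square : ∀ {X Y O O'} {f : X ⇒ O} {f' : Y ⇒ O'} {h : X ⇒ Y} {u : O ⇒ O'} →
             𝒪.Mor u → (sq : u ∘ f ≈ f' ∘ h) →
             α f' ∘ T.F₁ h ≈ T.F₁ (T̄sq h u sq) ∘ α f
  α-square {f = f} {f'} {h} {u} u∈𝒪 sq = begin
    α f' ∘ T.F₁ h                           ≈⟨ α-natural h (≈-sym sq) ⟨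
    T.F₁ (T̄₁ h (≈-sym sq)) ∘ α (u ∘ f)      ≈⟨ ∘-resp-≈ ≈-refl (θ∘α u u∈𝒪 f) ⟨
    T.F₁ (T̄₁ h (≈-sym sq)) ∘ (T.F₁ (θ u f) ∘ α f)  ≈⟨ pullˡ (≈-sym T.homomorphism) ⟩
    T.F₁ (T̄sq h u sq) ∘ α f                 ∎

  Fμ∘λ-natural : ∀ {X Y} (h : X ⇒ Y) →
                 (F.F₁ (T.μ Y) ∘ L.λ′ (T.F₀ Y)) ∘ T.F₁ (F.F₁ (T.F₁ h))
                 ≈ F.F₁ (T.F₁ h) ∘ (F.F₁ (T.μ X) ∘ L.λ′ (T.F₀ X))
  Fμ∘λ-natural {X} {Y} h = begin
    (F.F₁ (T.μ Y) ∘ L.λ′ (T.F₀ Y)) ∘ T.F₁ (F.F₁ (T.F₁ h))  ≈⟨ pullʳ (≈-sym (L.natural (T.F₁ h))) ⟩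
    F.F₁ (T.μ Y) ∘ (F.F₁ (T.F₁ (T.F₁ h)) ∘ L.λ′ (T.F₀ X))   ≈⟨ pullˡ (F-resp-square F (≈-sym (T.μ-natural h))) ⟩
    (F.F₁ (T.F₁ h) ∘ F.F₁ (T.μ X)) ∘ L.λ′ (T.F₀ X)          ≈⟨ assoc ⟩
    F.F₁ (T.F₁ h) ∘ (F.F₁ (T.μ X) ∘ L.λ′ (T.F₀ X))          ∎

  Det-natural : ∀ {S S'} {δ : S ⇒ F.F₀ (T.F₀ S)} {δ' : S' ⇒ F.F₀ (T.F₀ S')} {h : S ⇒ S'} →
                δ' ∘ h ≈ F.F₁ (T.F₁ h) ∘ δ →
                Det δ' ∘ T.F₁ h ≈ F.F₁ (T.F₁ h) ∘ Det δ
  Det-natural {S} {S'} {δ} {δ'} {h} coalg-h = begin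
    ((F.F₁ (T.μ S') ∘ L.λ′ (T.F₀ S')) ∘ T.F₁ δ') ∘ T.F₁ h
      ≈⟨ pullʳ (F-resp-square T.functor coalg-h) ⟩
    (F.F₁ (T.μ S') ∘ L.λ′ (T.F₀ S')) ∘ (T.F₁ (F.F₁ (T.F₁ h)) ∘ T.F₁ δ)
      ≈⟨ pullˡ (Fμ∘λ-natural h) ⟩
    (F.F₁ (T.F₁ h) ∘ (F.F₁ (T.μ S) ∘ L.λ′ (T.F₀ S))) ∘ T.F₁ δ
      ≈⟨ assoc ⟩
    F.F₁ (T.F₁ h) ∘ Det δ
      ∎

  belief-map : ∀ {X Y} → PHom X Y → S (Bel₀ X) ⇒ S (Bel₀ Y)
  belief-map m = T̄sq (f m) (g m) (observe m)

  belief-map-coalg : ∀ {X Y} (m : PHom X Y) →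
                     cBel Y ∘ belief-map m ≈ F.F₁ (T.F₁ (belief-map m)) ∘ cBel X
  belief-map-coalg {X} {Y} m = begin
    (F.F₁ (α (obs Y)) ∘ (Det (δ Y) ∘ ι (obs Y))) ∘ belief-map m
      ≈⟨ pullʳ (pullʳ ι∘T̄sq) ⟩
    F.F₁ (α (obs Y)) ∘ (Det (δ Y) ∘ (T.F₁ (f m) ∘ ι (obs X)))
      ≈⟨ ∘-resp-≈ ≈-refl (extendʳ (Det-natural (coalg m))) ⟩
    F.F₁ (α (obs Y)) ∘ (F.F₁ (T.F₁ (f m)) ∘ (Det (δ X) ∘ ι (obs X)))
      ≈⟨ pullˡ (F-resp-square F (α-square (g∈𝒪 m) (observe m))) ⟩
    (F.F₁ (T.F₁ (belief-map m)) ∘ F.F₁ (α (obs X))) ∘ (Det (δ X) ∘ ι (obs X))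
      ≈⟨ assoc ⟩
    F.F₁ (T.F₁ (belief-map m)) ∘ cBel X
      ∎

  Bel₁ : ∀ {X Y} → PHom X Y → PHom (Bel₀ X) (Bel₀ Y)
  Bel₁ m = record
    { f = belief-map m
    ; g = g m
    ; g∈𝒪 = g∈𝒪 m
    ; pointed = ≈-trans (pullˡ T̄sq∘η̄) (pullʳ (pointed m))
    ; coalg = belief-map-coalg m
    ; observe = ≈-sym T̄∘T̄sq
    }

  Bel : FunctorExtending Coalg Coalg Bel₀
  Bel = record
    { F₁ = Bel₁
    ; F-resp-≈ = λ (f≈f' , g≈g') → T̄sq-resp-≈ f≈f' g≈g' , g≈g'
    ; identity = T̄sq-identity , ≈-refl
    ; homomorphism = T̄sq-homomorphism , ≈-refl
    }

proposition4p5 : ∀ {o ℓ e p} (C : Category o ℓ e) (prods : FiniteProducts C)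
                   (pbs : ChosenPullbacks C) (𝒪 : WideSubcategory C p)
                   (F : Endofunctor C) (T : Monad C) (L : DistributiveLaw C F T)
                   (I : Category.Obj C) (B : BeliefDecomposition C pbs 𝒪 T) →
                   let open Category C
                       open POCoalg C pbs 𝒪 F T L I B
                   in Σ (FunctorExtending Coalg Coalg Bel₀) λ G →
                        ∀ {X Y : PObj} (m : PHom X Y) →
                          (PHom.f (FunctorExtending.F₁ G m)
                             ≈ T̄₁ (PHom.f m) (≈-sym (PHom.observe m))
                                 ∘ θ (PHom.g m) (PObj.obs X))
                          × (PHom.g (FunctorExtending.F₁ G m) ≈ PHom.g m)
proposition4p5 C _ pbs 𝒪 F T L I B =
  BeliefFunctor.Bel C pbs 𝒪 F T L I B , λ _ → Category.≈-refl C , Category.≈-refl C
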